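{- Let $(V,E,F,H)$ be an instance of Constrained Correlation Clustering admitting a valid clustering, let $\mathrm{OPT}$ be the edge set of an optimal valid clustering, and let $E_3$ be the edge set obtained in the third step of $\textsc{Transform}(G,F,H)$ (just before the rounding step). Let $S$ be the set of all unordered pairs $\{U,W\}$ of distinct supernodes that lie in the same cluster of the optimal clustering. Then $|E\triangle\mathrm{OPT}|\ge\sum_{\{U,W\}\in S}|E(U,W)\triangle E_3(U,W)|$.
   Context: A clustering of $V$ is a partition; its edge set is the set of pairs inside a common part. Instance: graph $G=(V,E)$, friendly pairs $F$, hostile pairs $H\subseteq\binom V2$; a clustering is valid if no pair of $F$ is split and no pair of $H$ shares a cluster; the cost is $|E\triangle E_C|$. Supernodes are the connected components of $(V,F)$; $s(u)$ is the supernode of $u$; supernodes $U,W$ are hostile if some $uw\in H$ has $u\in U, w\in W$. For disjoint $U,W\subseteq V$ and an edge set $E^*$, $E^*(U,W)$ denotes the edges of $E^*$ with one endpoint in $U$ and the other in $W$. $\textsc{Transform}$ (in the satisfiable case, where no supernode is hostile to itself) computes: $E_1=E\cup\{uv:s(u)=s(v)\}$; $E_2=E_1\setminus\{uv: s(u),s(v)\text{ hostile}\}$; then $E_3\gets E_2$ and, while there exist three distinct supernodes $U_1,U_2,U_3$ with $U_1,U_2$ hostile and $u_1\in U_1,u_2\in U_2,u_3,u_3'\in U_3$ with $u_1u_3,u_2u_3'\in E_3$, it removes $u_1u_3$ and $u_2u_3'$ from $E_3$. -}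

module Defs where

open import Data.Nat using (ℕ; zero; suc; _+_; _≤_; _<ᵇ_)
open import Data.Fin using (Fin; toℕ)
import Data.Fin
open import Data.Fin.Properties using (_≟_)
open import Data.Bool using (Bool; true; false; _∧_; _∨_; not; _xor_; if_then_else_)
open import Data.Sum using (_⊎_)
open import Data.Product using (_×_)
open import Relation.Nullary using (¬_)
open import Relation.Nullary.Decidable using (⌊_⌋)
open import Relation.Binary.PropositionalEquality using (_≡_; _≢_)
open import Relation.Binary.Construct.Closure.ReflexiveTransitive using (Star)
open import Function.Bundles using (_⇔_)

-- A set of pairs (graph edges, friendly pairs, hostile pairs) is given by a
-- Boolean matrix; the unordered pair {u,v} (u ≠ v) belongs to it iff
-- R u v = true or R v u = true.  Loops are never pairs.
PairSet : ℕ → Set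
PairSet n = Fin n → Fin n → Bool

_==_ : ∀ {n} → Fin n → Fin n → Bool
a == b = ⌊ a ≟ b ⌋

adj : ∀ {n} → PairSet n → Fin n → Fin n → Bool
adj R u v = (R u v ∨ R v u) ∧ not (u == v)

InPair : ∀ {n} → PairSet n → Fin n → Fin n → Set
InPair R u v = adj R u v ≡ true

ΣFin : ∀ n → (Fin n → ℕ) → ℕ
ΣFin zero    f = 0
ΣFin (suc n) f = f Data.Fin.zero + ΣFin n (λ i → f (Data.Fin.suc i))

anyFin : ∀ n → (Fin n → Bool) → Bool
anyFin zero    f = false
anyFin (suc n) f = f Data.Fin.zero ∨ anyFin n (λ i → f (Data.Fin.suc i))

ind : Bool → ℕ
ind b = if b then 1 else 0

countPairs : ∀ n → (Fin n → Fin n → Bool) → ℕ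
countPairs n P = ΣFin n (λ u → ΣFin n (λ v → ind ((toℕ u <ᵇ toℕ v) ∧ P u v)))

-- Clusterings: a partition of V given by a cluster label c : V → Fin n
-- (every partition of an n-element set admits such a labelling).

Clustering : ℕ → Set
Clustering n = Fin n → Fin n

clusterEdges : ∀ {n} → Clustering n → PairSet n
clusterEdges c u v = c u == c v

Valid : ∀ {n} → (F H : PairSet n) → Clustering n → Set
Valid F H c = (∀ u v → InPair F u v → c u ≡ c v)
            × (∀ u v → InPair H u v → c u ≢ c v)

cost : ∀ {n} → PairSet n → Clustering n → ℕ
cost {n} E c = countPairs n (λ u v → adj E u v xor adj (clusterEdges c) u v)

OptimalValid : ∀ {n} → (E F H : PairSet n) → Clustering n → Set
OptimalValid E F H c = Valid F H c × (∀ c' → Valid F H c' → cost E c ≤ cost E c')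

-- Supernodes: connected components of (V,F).  They are represented by a
-- labelling s : V → Fin n with s u ≡ s v iff u,v are connected in (V,F);
-- a supernode is then identified with its label (an element of the image of s).

ConnectedF : ∀ {n} → PairSet n → Fin n → Fin n → Set
ConnectedF F = Star (InPair F)

IsSupernodeLabelling : ∀ {n} → PairSet n → (Fin n → Fin n) → Set
IsSupernodeLabelling {n} F s = (u v : Fin n) → (s u ≡ s v) ⇔ ConnectedF F u v

hostileSN : ∀ {n} → (s : Fin n → Fin n) → PairSet n → Fin n → Fin n → Bool
hostileSN {n} s H U W =
  anyFin n (λ a → anyFin n (λ b → adj H a b ∧ (s a == U) ∧ (s b == W)))

E₁ : ∀ {n} → (s : Fin n → Fin n) → PairSet n → PairSet n
E₁ s E u v = adj E u v ∨ ((s u == s v) ∧ not (u == v))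

E₂ : ∀ {n} → (s : Fin n → Fin n) → (E H : PairSet n) → PairSet n
E₂ s E H u v = E₁ s E u v ∧ not (hostileSN s H (s u) (s v))

samePair : ∀ {n} → Fin n → Fin n → Fin n → Fin n → Bool
samePair u v a b = ((u == a) ∧ (v == b)) ∨ ((u == b) ∧ (v == a))

remove2 : ∀ {n} → PairSet n → Fin n → Fin n → Fin n → Fin n → PairSet n
remove2 E a b c d u v = E u v ∧ not (samePair u v a b) ∧ not (samePair u v c d)

data Step {n} (s : Fin n → Fin n) (H : PairSet n) : PairSet n → PairSet n → Set where
  step : ∀ {E} (u₁ u₂ u₃ u₃' : Fin n) →
         s u₁ ≢ s u₂ → s u₁ ≢ s u₃ → s u₂ ≢ s u₃ →
         s u₃ ≡ s u₃' →
         hostileSN s H (s u₁) (s u₂) ≡ true →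
         InPair E u₁ u₃ → InPair E u₂ u₃' →
         Step s H E (remove2 E u₁ u₃ u₂ u₃')

IsE₃ : ∀ {n} → (s : Fin n → Fin n) → (E H : PairSet n) → PairSet n → Set
IsE₃ s E H E₃ = Star (Step s H) (E₂ s E H) E₃ × (∀ E' → ¬ Step s H E₃ E')

-- |E(U,W) △ E₃(U,W)| for distinct supernodes U, W (labels):
-- ordered pairs (u,w) with s u = U, s w = W count each cross pair once.
crossDiff : ∀ {n} → (s : Fin n → Fin n) → (E E' : PairSet n) → Fin n → Fin n → ℕ
crossDiff {n} s E E' U W =
  ΣFin n (λ u → ΣFin n (λ w →
    ind ((s u == U) ∧ (s w == W) ∧ (adj E u w xor adj E' u w))))

inSameClusterSN : ∀ {n} → (s : Fin n → Fin n) → Clustering n → Fin n → Fin n → Bool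
inSameClusterSN {n} s c U W =
  anyFin n (λ u → anyFin n (λ w → (s u == U) ∧ (s w == W) ∧ (c u == c w)))

sumS : ∀ {n} → (s : Fin n → Fin n) → Clustering n → (E E' : PairSet n) → ℕ
sumS {n} s c E E' =
  ΣFin n (λ U → ΣFin n (λ W →
    if (toℕ U <ᵇ toℕ W) ∧ inSameClusterSN s c U W
    then crossDiff s E E' U W else 0))

-- Follow two counts along the loop of step 3: the edges of E deleted so far
-- that lie inside a cluster of the valid clustering c, and those that lie
-- between two clusters.  In E₂ nothing inside a cluster is missing, because c
-- never joins hostile supernodes.  An iteration deletes u₁u₃ and u₂u₃' with
-- u₃, u₃' in one supernode and u₁, u₂ in hostile supernodes, which c separates;
-- so at most one of the two lies inside a cluster, and the inside count never
-- exceeds the across count.  Between distinct supernodes E₃ ⊆ E, so the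
-- left-hand side is at most the final inside count, while every missing edge
-- between clusters is an error of c and is counted by its cost.
module Submission where

open import Defs
open import Algebra.Bundles using (CommutativeMonoid)
open import Data.Bool using (Bool; true; false; _∧_; _∨_; not; _xor_; if_then_else_)
open import Data.Bool.Properties
  using ( ∧-assoc; ∧-comm; ∨-comm; ∧-identityʳ; ∧-zeroʳ; ¬-not; not-injective; T-≡
        ; ∧-commutativeMonoid )
open import Data.Empty using (⊥; ⊥-elim)
open import Data.Fin using (Fin; toℕ)
import Data.Fin as F
open import Data.Fin.Properties using (_≟_; toℕ-injective)
open import Data.Nat using (ℕ; zero; suc; _+_; _≤_; _<_; _<ᵇ_; z≤n; s≤s)
open import Data.Nat.Properties
  using ( ≤-refl; ≤-trans; ≤-reflexive; +-mono-≤; +-monoˡ-≤; +-monoʳ-≤; +-assoc; +-identityʳ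
        ; m≤m+n; m≤n+m; <⇒≢; <-asym; <-cmp; <ᵇ⇒<; <⇒<ᵇ; +-0-commutativeMonoid; module ≤-Reasoning )
open import Data.Product using (_×_; _,_; proj₁; proj₂; ∃)
open import Data.Sum using (_⊎_; inj₁; inj₂; [_,_]′)
open import Function using (_∘_; id)
open import Function.Bundles using (Equivalence)
open import Relation.Binary.Construct.Closure.ReflexiveTransitive using (Star; fold)
open import Relation.Binary.Definitions using (tri<; tri≈; tri>)
open import Relation.Binary.PropositionalEquality
open import Relation.Nullary using (yes; no)

open import Algebra.Properties.CommutativeMonoid.Sum +-0-commutativeMonoid
  using (sum; ∑-distrib-+; ∑-comm; sum-replicate-zero)
open import Algebra.Properties.CommutativeSemigroup
  (CommutativeMonoid.commutativeSemigroup ∧-commutativeMonoid)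
  using () renaming (x∙yz≈y∙xz to ∧-swap)

∧-elim : ∀ a {b} → (a ∧ b) ≡ true → a ≡ true × b ≡ true
∧-elim true b≡true = refl , b≡true

∧-intro : ∀ {a b} → a ≡ true → b ≡ true → (a ∧ b) ≡ true
∧-intro refl b≡true = b≡true

∨-elim : ∀ a {b} → (a ∨ b) ≡ true → a ≡ true ⊎ b ≡ true
∨-elim true  _      = inj₁ refl
∨-elim false b≡true = inj₂ b≡true

xor-⊆ : ∀ e x → (x ≡ true → e ≡ true) → (e xor x) ≡ true → (e ∧ not x) ≡ true
xor-⊆ true  x _   e⊕x = e⊕x
xor-⊆ false x x⇒e e⊕x = x⇒e e⊕x

anyFin-∃ : ∀ n (f : Fin n → Bool) → anyFin n f ≡ true → ∃ λ i → f i ≡ true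
anyFin-∃ (suc n) f h with ∨-elim (f F.zero) h
... | inj₁ f0 = F.zero , f0
... | inj₂ fs = let i , fi = anyFin-∃ n (f ∘ F.suc) fs in F.suc i , fi

==⇒≡ : ∀ {n} (a b : Fin n) → (a == b) ≡ true → a ≡ b
==⇒≡ a b h with a ≟ b
... | yes a≡b = a≡b

≡⇒== : ∀ {n} {a b : Fin n} → a ≡ b → (a == b) ≡ true
≡⇒== {a = a} refl with a ≟ a
... | yes _  = refl
... | no a≢a = ⊥-elim (a≢a refl)

≢⇒== : ∀ {n} {a b : Fin n} → a ≢ b → (a == b) ≡ false
≢⇒== {a = a} {b} a≢b = ¬-not (a≢b ∘ ==⇒≡ a b)

==-sym : ∀ {n} (a b : Fin n) → (a == b) ≡ (b == a)
==-sym a b with a ≟ b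
... | yes refl = sym (≡⇒== refl)
... | no a≢b   = sym (≢⇒== (a≢b ∘ sym))

==-suc : ∀ {n} (a b : Fin n) → (F.suc a == F.suc b) ≡ (a == b)
==-suc a b with a ≟ b
... | yes refl = refl
... | no _     = refl

samePair-sym : ∀ {n} (u v a b : Fin n) → samePair u v a b ≡ samePair v u a b
samePair-sym u v a b =
  trans (∨-comm (u == a ∧ v == b) (u == b ∧ v == a))
        (cong₂ _∨_ (∧-comm (u == b) (v == a)) (∧-comm (u == a) (v == b)))

samePair-refl : ∀ {n} (a b : Fin n) → samePair a b a b ≡ true
samePair-refl a b rewrite ≡⇒== {a = a} refl | ≡⇒== {a = b} refl = refl

samePair⇒ : ∀ {n} (u v a b : Fin n) → samePair u v a b ≡ true →
            (u ≡ a × v ≡ b) ⊎ (u ≡ b × v ≡ a)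
samePair⇒ u v a b h with ∨-elim (u == a ∧ v == b) h
... | inj₁ p = let u≡a , v≡b = ∧-elim (u == a) p in inj₁ (==⇒≡ u a u≡a , ==⇒≡ v b v≡b)
... | inj₂ p = let u≡b , v≡a = ∧-elim (u == b) p in inj₂ (==⇒≡ u b u≡b , ==⇒≡ v a v≡a)

adj-sym : ∀ {n} (R : PairSet n) u v → adj R u v ≡ adj R v u
adj-sym R u v = cong₂ _∧_ (∨-comm (R u v) (R v u)) (cong not (==-sym u v))

adj-cong : ∀ {n} {R R' : PairSet n} → (∀ u v → R u v ≡ R' u v) → ∀ u v → adj R u v ≡ adj R' u v
adj-cong R≗R' u v = cong₂ (λ x y → (x ∨ y) ∧ not (u == v)) (R≗R' u v) (R≗R' v u)

<ᵇ⇒<′ : ∀ m k → (m <ᵇ k) ≡ true → m < k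
<ᵇ⇒<′ m k h = <ᵇ⇒< m k (Equivalence.from T-≡ h)

<ᵇ-asym : ∀ m k → (m <ᵇ k) ≡ true → (k <ᵇ m) ≡ true → ⊥
<ᵇ-asym m k m<k k<m = <-asym (<ᵇ⇒<′ m k m<k) (<ᵇ⇒<′ k m k<m)

<ᵇ-total : ∀ m k → m ≢ k → (m <ᵇ k) ≡ false → (k <ᵇ m) ≡ true
<ᵇ-total m k m≢k m≮k with <-cmp m k
... | tri< m<k _ _ with () ← trans (sym m≮k) (Equivalence.to T-≡ (<⇒<ᵇ m<k))
... | tri≈ _ m≡k _ = ⊥-elim (m≢k m≡k)
... | tri> _ _ k<m = Equivalence.to T-≡ (<⇒<ᵇ k<m)

ind-mono : ∀ {a b} → (a ≡ true → b ≡ true) → ind a ≤ ind b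
ind-mono {false} _   = z≤n
ind-mono {true}  a⇒b rewrite a⇒b refl = ≤-refl

ind-split : ∀ l p q t → (p ≡ true → q ≡ true ⊎ t ≡ true) →
            ind (l ∧ p) ≤ ind (l ∧ q) + ind (t ∧ (l ∧ p))
ind-split false p     q t _ = z≤n
ind-split true  false q t _ = z≤n
ind-split true  true  q t p⇒q∨t with p⇒q∨t refl
... | inj₁ refl = s≤s z≤n
... | inj₂ refl = m≤n+m 1 (ind q)

ind-merge : ∀ l p q t → (q ≡ true → p ≡ true) → (t ≡ true → q ≡ false) →
            ind (l ∧ q) + ind (t ∧ (l ∧ p)) ≤ ind (l ∧ p)
ind-merge false p q t     _   _    rewrite ∧-zeroʳ t = z≤n
ind-merge true  p q false q⇒p _    = ≤-trans (≤-reflexive (+-identityʳ (ind q))) (ind-mono q⇒p)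
ind-merge true  p q true  _   t⇒¬q rewrite t⇒¬q refl = ≤-refl

ind-exclusive-≤ : ∀ l l' p → (l ≡ true → l' ≡ true → ⊥) → ind (l ∧ p) + ind (l' ∧ p) ≤ ind p
ind-exclusive-≤ true  true  p l∧l' = ⊥-elim (l∧l' refl refl)
ind-exclusive-≤ true  false p _    = ≤-reflexive (+-identityʳ (ind p))
ind-exclusive-≤ false true  p _    = ≤-refl
ind-exclusive-≤ false false p _    = z≤n

ind-exhaustive-≥ : ∀ l l' p → (l ≡ false → l' ≡ true) → ind p ≤ ind (l ∧ p) + ind (l' ∧ p)
ind-exhaustive-≥ true  l' p _     = m≤m+n (ind p) (ind (l' ∧ p))
ind-exhaustive-≥ false l' p ¬l⇒l' rewrite ¬l⇒l' refl = ≤-refl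

ind-not-pair : ∀ x y → (x ≡ true → y ≡ true → ⊥) → ind x + ind y ≤ ind (not x) + ind (not y)
ind-not-pair true  true  x∧y = ⊥-elim (x∧y refl refl)
ind-not-pair true  false _   = ≤-refl
ind-not-pair false true  _   = ≤-refl
ind-not-pair false false _   = z≤n

ind-∨-disjoint : ∀ x y x' y' k → (x ≡ true → x' ≡ true → ⊥) →
                 ind ((x ∧ y ∨ x' ∧ y') ∧ k) ≡ ind (x ∧ (y ∧ k)) + ind (x' ∧ (y' ∧ k))
ind-∨-disjoint true  y     true  y' k x∧x' = ⊥-elim (x∧x' refl refl)
ind-∨-disjoint true  true  false y' k _    = sym (+-identityʳ (ind k))
ind-∨-disjoint true  false false y' k _    = refl
ind-∨-disjoint false y     x'    y' k _    = cong ind (∧-assoc x' y' k)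

ΣFin≡sum : ∀ n (f : Fin n → ℕ) → ΣFin n f ≡ sum f
ΣFin≡sum zero    f = refl
ΣFin≡sum (suc n) f = cong (f F.zero +_) (ΣFin≡sum n (f ∘ F.suc))

ΣFin-cong : ∀ n {f g : Fin n → ℕ} → (∀ i → f i ≡ g i) → ΣFin n f ≡ ΣFin n g
ΣFin-cong zero    f≗g = refl
ΣFin-cong (suc n) f≗g = cong₂ _+_ (f≗g F.zero) (ΣFin-cong n (f≗g ∘ F.suc))

ΣFin-mono : ∀ n {f g : Fin n → ℕ} → (∀ i → f i ≤ g i) → ΣFin n f ≤ ΣFin n g
ΣFin-mono zero    f≤g = z≤n
ΣFin-mono (suc n) f≤g = +-mono-≤ (f≤g F.zero) (ΣFin-mono n (f≤g ∘ F.suc))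

ΣFin-zero : ∀ n → ΣFin n (λ _ → 0) ≡ 0
ΣFin-zero n = trans (ΣFin≡sum n _) (sum-replicate-zero n)

ΣFin-+ : ∀ n (f g : Fin n → ℕ) → ΣFin n (λ i → f i + g i) ≡ ΣFin n f + ΣFin n g
ΣFin-+ n f g = begin
  ΣFin n (λ i → f i + g i) ≡⟨ ΣFin≡sum n _ ⟩
  sum (λ i → f i + g i)    ≡⟨ ∑-distrib-+ f g ⟩
  sum f + sum g            ≡⟨ cong₂ _+_ (ΣFin≡sum n f) (ΣFin≡sum n g) ⟨
  ΣFin n f + ΣFin n g      ∎
  where open ≡-Reasoning

ΣFin-comm : ∀ m n (f : Fin m → Fin n → ℕ) →
            ΣFin m (λ i → ΣFin n (f i)) ≡ ΣFin n (λ j → ΣFin m (λ i → f i j))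
ΣFin-comm m n f = begin
  ΣFin m (λ i → ΣFin n (f i))          ≡⟨ ΣFin-cong m (λ i → ΣFin≡sum n (f i)) ⟩
  ΣFin m (λ i → sum (f i))             ≡⟨ ΣFin≡sum m _ ⟩
  sum (λ i → sum (f i))                ≡⟨ ∑-comm f ⟩
  sum (λ j → sum (λ i → f i j))        ≡⟨ ΣFin≡sum n _ ⟨
  ΣFin n (λ j → sum (λ i → f i j))     ≡⟨ ΣFin-cong n (λ j → ΣFin≡sum m (λ i → f i j)) ⟨
  ΣFin n (λ j → ΣFin m (λ i → f i j))  ∎
  where open ≡-Reasoning

ΣFin-δ : ∀ n (a : Fin n) (K : Fin n → Bool) → ΣFin n (λ i → ind ((i == a) ∧ K i)) ≡ ind (K a)
ΣFin-δ (suc n) F.zero    K = trans (cong (ind (K F.zero) +_) (ΣFin-zero n)) (+-identityʳ _)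
ΣFin-δ (suc n) (F.suc a) K =
  trans (ΣFin-cong n (λ i → cong (λ t → ind (t ∧ K (F.suc i))) (==-suc i a)))
        (ΣFin-δ n a (K ∘ F.suc))

ΣΣ : ∀ n → (Fin n → Fin n → ℕ) → ℕ
ΣΣ n f = ΣFin n (λ u → ΣFin n (λ w → f u w))

ΣΣ-cong : ∀ n {f g : Fin n → Fin n → ℕ} → (∀ u w → f u w ≡ g u w) → ΣΣ n f ≡ ΣΣ n g
ΣΣ-cong n f≗g = ΣFin-cong n (λ u → ΣFin-cong n (f≗g u))

ΣΣ-mono : ∀ n {f g : Fin n → Fin n → ℕ} → (∀ u w → f u w ≤ g u w) → ΣΣ n f ≤ ΣΣ n g
ΣΣ-mono n f≤g = ΣFin-mono n (λ u → ΣFin-mono n (f≤g u))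

ΣΣ-zero : ∀ n → ΣΣ n (λ _ _ → 0) ≡ 0
ΣΣ-zero n = trans (ΣFin-cong n (λ _ → ΣFin-zero n)) (ΣFin-zero n)

ΣΣ-+ : ∀ n (f g : Fin n → Fin n → ℕ) → ΣΣ n (λ u w → f u w + g u w) ≡ ΣΣ n f + ΣΣ n g
ΣΣ-+ n f g = trans (ΣFin-cong n (λ u → ΣFin-+ n (f u) (g u))) (ΣFin-+ n _ _)

ΣΣ-comm : ∀ n (f : Fin n → Fin n → Fin n → Fin n → ℕ) →
          ΣΣ n (λ U W → ΣΣ n (f U W)) ≡ ΣΣ n (λ u w → ΣΣ n (λ U W → f U W u w))
ΣΣ-comm n f = begin
  ΣFin n (λ U → ΣFin n (λ W → ΣFin n (λ u → ΣFin n (f U W u))))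
    ≡⟨ ΣFin-cong n (λ U → ΣFin-comm n n (λ W u → ΣFin n (f U W u))) ⟩
  ΣFin n (λ U → ΣFin n (λ u → ΣFin n (λ W → ΣFin n (f U W u))))
    ≡⟨ ΣFin-comm n n (λ U u → ΣFin n (λ W → ΣFin n (f U W u))) ⟩
  ΣFin n (λ u → ΣFin n (λ U → ΣFin n (λ W → ΣFin n (f U W u))))
    ≡⟨ ΣFin-cong n (λ u → ΣFin-cong n (λ U → ΣFin-comm n n (λ W w → f U W u w))) ⟩
  ΣFin n (λ u → ΣFin n (λ U → ΣFin n (λ w → ΣFin n (λ W → f U W u w))))
    ≡⟨ ΣFin-cong n (λ u → ΣFin-comm n n (λ U w → ΣFin n (λ W → f U W u w))) ⟩
  ΣFin n (λ u → ΣFin n (λ w → ΣFin n (λ U → ΣFin n (λ W → f U W u w))))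
    ∎
  where open ≡-Reasoning

ΣΣ-δ : ∀ n (a b : Fin n) (K : Fin n → Fin n → Bool) →
       ΣΣ n (λ i j → ind ((i == a) ∧ ((j == b) ∧ K i j))) ≡ ind (K a b)
ΣΣ-δ n a b K = trans (ΣFin-cong n inner) (ΣFin-δ n a (λ i → K i b))
  where
  inner : ∀ i → ΣFin n (λ j → ind ((i == a) ∧ ((j == b) ∧ K i j))) ≡ ind ((i == a) ∧ K i b)
  inner i = trans (ΣFin-cong n (λ j → cong ind (∧-swap (i == a) (j == b) (K i j))))
                  (ΣFin-δ n b (λ j → (i == a) ∧ K i j))

ΣΣ-samePair : ∀ n {a b : Fin n} → a ≢ b → (K : Fin n → Fin n → Bool) →
              ΣΣ n (λ u w → ind (samePair u w a b ∧ K u w)) ≡ ind (K a b) + ind (K b a)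
ΣΣ-samePair n {a} {b} a≢b K = begin
  ΣΣ n (λ u w → ind (samePair u w a b ∧ K u w))
    ≡⟨ ΣΣ-cong n (λ u w → ind-∨-disjoint (u == a) (w == b) (u == b) (w == a) (K u w)
                           (λ u≡a u≡b → a≢b (trans (sym (==⇒≡ u a u≡a)) (==⇒≡ u b u≡b)))) ⟩
  ΣΣ n (λ u w → ind ((u == a) ∧ ((w == b) ∧ K u w)) + ind ((u == b) ∧ ((w == a) ∧ K u w)))
    ≡⟨ ΣΣ-+ n _ _ ⟩
  ΣΣ n (λ u w → ind ((u == a) ∧ ((w == b) ∧ K u w)))
    + ΣΣ n (λ u w → ind ((u == b) ∧ ((w == a) ∧ K u w)))
    ≡⟨ cong₂ _+_ (ΣΣ-δ n a b K) (ΣΣ-δ n b a K) ⟩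
  ind (K a b) + ind (K b a)
    ∎
  where open ≡-Reasoning

Symmetricᵇ : ∀ {n} → (Fin n → Fin n → Bool) → Set
Symmetricᵇ {n} P = (u w : Fin n) → P u w ≡ P w u

-- For symmetric P, every pair {u,w} with k u ≢ k w is counted once;
-- countPairs n is pairsBy toℕ.
pairsBy : ∀ {n} → (Fin n → ℕ) → (Fin n → Fin n → Bool) → ℕ
pairsBy {n} k P = ΣΣ n (λ u w → ind ((k u <ᵇ k w) ∧ P u w))

pairsBy-≤-insert : ∀ {n} (k : Fin n → ℕ) (P Q : Fin n → Fin n → Bool) {a b : Fin n} →
                   a ≢ b → Symmetricᵇ P →
                   (∀ u w → P u w ≡ true → Q u w ≡ true ⊎ samePair u w a b ≡ true) →
                   pairsBy k P ≤ pairsBy k Q + ind (P a b)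
pairsBy-≤-insert {n} k P Q {a} {b} a≢b symP P⊆Q+ab = begin
  pairsBy k P
    ≤⟨ ΣΣ-mono n (λ u w → ind-split (l u w) (P u w) (Q u w) (samePair u w a b) (P⊆Q+ab u w)) ⟩
  ΣΣ n (λ u w → ind (l u w ∧ Q u w) + ind (samePair u w a b ∧ (l u w ∧ P u w)))
    ≡⟨ ΣΣ-+ n _ _ ⟩
  pairsBy k Q + ΣΣ n (λ u w → ind (samePair u w a b ∧ (l u w ∧ P u w)))
    ≡⟨ cong (pairsBy k Q +_) (ΣΣ-samePair n a≢b (λ u w → l u w ∧ P u w)) ⟩
  pairsBy k Q + (ind (l a b ∧ P a b) + ind (l b a ∧ P b a))
    ≡⟨ cong (λ p → pairsBy k Q + (ind (l a b ∧ P a b) + ind (l b a ∧ p))) (symP b a) ⟩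
  pairsBy k Q + (ind (l a b ∧ P a b) + ind (l b a ∧ P a b))
    ≤⟨ +-monoʳ-≤ (pairsBy k Q) (ind-exclusive-≤ (l a b) (l b a) (P a b) (<ᵇ-asym (k a) (k b))) ⟩
  pairsBy k Q + ind (P a b)
    ∎
  where
  open ≤-Reasoning
  l : Fin n → Fin n → Bool
  l u w = k u <ᵇ k w

pairsBy-insert-≤ : ∀ {n} (k : Fin n → ℕ) (P Q : Fin n → Fin n → Bool) {a b : Fin n} →
                   k a ≢ k b → Symmetricᵇ P → Symmetricᵇ Q →
                   (∀ u w → Q u w ≡ true → P u w ≡ true) → Q a b ≡ false →
                   pairsBy k Q + ind (P a b) ≤ pairsBy k P
pairsBy-insert-≤ {n} k P Q {a} {b} ka≢kb symP symQ Q⊆P ab∉Q = begin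
  pairsBy k Q + ind (P a b)
    ≤⟨ +-monoʳ-≤ (pairsBy k Q)
                 (ind-exhaustive-≥ (l a b) (l b a) (P a b) (<ᵇ-total (k a) (k b) ka≢kb)) ⟩
  pairsBy k Q + (ind (l a b ∧ P a b) + ind (l b a ∧ P a b))
    ≡⟨ cong (λ p → pairsBy k Q + (ind (l a b ∧ P a b) + ind (l b a ∧ p))) (symP a b) ⟩
  pairsBy k Q + (ind (l a b ∧ P a b) + ind (l b a ∧ P b a))
    ≡⟨ cong (pairsBy k Q +_) (ΣΣ-samePair n (ka≢kb ∘ cong k) (λ u w → l u w ∧ P u w)) ⟨
  pairsBy k Q + ΣΣ n (λ u w → ind (samePair u w a b ∧ (l u w ∧ P u w)))
    ≡⟨ ΣΣ-+ n _ _ ⟨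
  ΣΣ n (λ u w → ind (l u w ∧ Q u w) + ind (samePair u w a b ∧ (l u w ∧ P u w)))
    ≤⟨ ΣΣ-mono n (λ u w → ind-merge (l u w) (P u w) (Q u w) (samePair u w a b)
                                    (Q⊆P u w) (pair∉Q u w)) ⟩
  pairsBy k P
    ∎
  where
  open ≤-Reasoning
  l : Fin n → Fin n → Bool
  l u w = k u <ᵇ k w
  pair∉Q : ∀ u w → samePair u w a b ≡ true → Q u w ≡ false
  pair∉Q u w sp with samePair⇒ u w a b sp
  ... | inj₁ (refl , refl) = ab∉Q
  ... | inj₂ (refl , refl) = trans (symQ b a) ab∉Q

missing : ∀ {n} → PairSet n → PairSet n → PairSet n
missing E X u w = adj E u w ∧ not (adj X u w)

missing-sym : ∀ {n} (E X : PairSet n) → Symmetricᵇ (missing E X)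
missing-sym E X u w = cong₂ _∧_ (adj-sym E u w) (cong not (adj-sym X u w))

record PairRemoved {n} (X : PairSet n) (a b : Fin n) (R : PairSet n) : Set where
  constructor pairRemoved
  field adj-removed : ∀ u w → adj R u w ≡ adj X u w ∧ not (samePair u w a b)
open PairRemoved

PairRemoved⇒⊆ : ∀ {n} {X R : PairSet n} {a b} → PairRemoved X a b R →
                ∀ {u w} → InPair R u w → InPair X u w
PairRemoved⇒⊆ {X = X} removed {u} {w} uw∈R =
  proj₁ (∧-elim (adj X u w) (trans (sym (adj-removed removed u w)) uw∈R))

without : ∀ {n} → PairSet n → Fin n → Fin n → PairSet n
without X a b u v = X u v ∧ not (samePair u v a b)

without-removes : ∀ {n} (X : PairSet n) a b → PairRemoved X a b (without X a b)
without-removes X a b = pairRemoved adj-without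
  where
  distrib : ∀ x y p q → (x ∧ p ∨ y ∧ p) ∧ q ≡ ((x ∨ y) ∧ q) ∧ p
  distrib x y true  q rewrite ∧-identityʳ x | ∧-identityʳ y = sym (∧-identityʳ _)
  distrib x y false q rewrite ∧-zeroʳ x | ∧-zeroʳ y = sym (∧-zeroʳ _)
  adj-without : ∀ u w → adj (without X a b) u w ≡ adj X u w ∧ not (samePair u w a b)
  adj-without u w rewrite samePair-sym w u a b =
    distrib (X u w) (X w u) (not (samePair u w a b)) (not (u == w))

remove2-removes : ∀ {n} (X : PairSet n) a b a' b' →
                  PairRemoved (without X a b) a' b' (remove2 X a b a' b')
remove2-removes X a b a' b' = pairRemoved λ u w →
  trans (adj-cong (λ u v → sym (∧-assoc (X u v) (not (samePair u v a b)) (not (samePair u v a' b'))))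
                  u w)
        (adj-removed (without-removes (without X a b) a' b') u w)

missingOn : ∀ {n} → PairSet n → (Fin n → Fin n → Bool) → PairSet n → PairSet n
missingOn E C X u w = C u w ∧ missing E X u w

missingOn-sym : ∀ {n} (E : PairSet n) {C} → Symmetricᵇ C → ∀ X → Symmetricᵇ (missingOn E C X)
missingOn-sym E symC X u w = cong₂ _∧_ (symC u w) (missing-sym E X u w)

module _ {n} (E : PairSet n) (k : Fin n → ℕ) (C : Fin n → Fin n → Bool) (symC : Symmetricᵇ C)
         {X R : PairSet n} {a b : Fin n} (removed : PairRemoved X a b R) where

  missingOn-removal-≤ : a ≢ b →
                        pairsBy k (missingOn E C R) ≤ pairsBy k (missingOn E C X) + ind (C a b)
  missingOn-removal-≤ a≢b = ≤-trans
    (pairsBy-≤-insert k (missingOn E C R) (missingOn E C X) a≢b (missingOn-sym E symC R) R⊆X+ab)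
    (+-monoʳ-≤ _ (ind-mono (proj₁ ∘ ∧-elim (C a b))))
    where
    grown : ∀ c e x t → (c ∧ e ∧ not (x ∧ not t)) ≡ true →
            (c ∧ e ∧ not x) ≡ true ⊎ t ≡ true
    grown c e x true  _ = inj₂ refl
    grown c e x false h rewrite ∧-identityʳ x = inj₁ h
    R⊆X+ab : ∀ u w → missingOn E C R u w ≡ true →
             missingOn E C X u w ≡ true ⊎ samePair u w a b ≡ true
    R⊆X+ab u w rewrite adj-removed removed u w =
      grown (C u w) (adj E u w) (adj X u w) (samePair u w a b)

  missingOn-removal-≥ : k a ≢ k b → InPair X a b → InPair E a b →
                        pairsBy k (missingOn E C X) + ind (C a b) ≤ pairsBy k (missingOn E C R)
  missingOn-removal-≥ ka≢kb ab∈X ab∈E =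
    subst (λ m → pairsBy k (missingOn E C X) + ind m ≤ pairsBy k (missingOn E C R))
          (trans (cong (C a b ∧_) ab∈missing) (∧-identityʳ (C a b)))
          (pairsBy-insert-≤ k (missingOn E C R) (missingOn E C X) ka≢kb
                            (missingOn-sym E symC R) (missingOn-sym E symC X) X⊆R ab∉X)
    where
    shrunk : ∀ c e x t → (c ∧ e ∧ not x) ≡ true → (c ∧ e ∧ not (x ∧ not t)) ≡ true
    shrunk c     e     false t h  = h
    shrunk true  true  true  t ()
    shrunk true  false true  t ()
    shrunk false e     true  t ()
    X⊆R : ∀ u w → missingOn E C X u w ≡ true → missingOn E C R u w ≡ true
    X⊆R u w rewrite adj-removed removed u w =
      shrunk (C u w) (adj E u w) (adj X u w) (samePair u w a b)
    ab∉X : missingOn E C X a b ≡ false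
    ab∉X rewrite ab∈X | ∧-zeroʳ (adj E a b) = ∧-zeroʳ (C a b)
    ab∈missing : missing E R a b ≡ true
    ab∈missing rewrite ab∈E | adj-removed removed a b | ab∈X | samePair-refl a b = refl

module ValidClustering {n} (E F H : PairSet n) (s : Fin n → Fin n)
                       (supernodes : IsSupernodeLabelling F s)
                       (c : Clustering n) (valid : Valid F H c) where

  sameSupernode⇒sameCluster : ∀ {u v} → s u ≡ s v → c u ≡ c v
  sameSupernode⇒sameCluster {u} {v} su≡sv =
    fold (λ x y → c x ≡ c y) (λ xy∈F cy≡cz → trans (proj₁ valid _ _ xy∈F) cy≡cz) refl
         (Equivalence.to (supernodes u v) su≡sv)

  hostile⇒separated : ∀ {u w} → hostileSN s H (s u) (s w) ≡ true → c u ≢ c w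
  hostile⇒separated {u} {w} hostile cu≡cw
    with a , a-hostile  ← anyFin-∃ n _ hostile
    with b , ab-hostile ← anyFin-∃ n _ a-hostile
    with ab∈H , labels  ← ∧-elim (adj H a b) ab-hostile
    with sa≡su , sb≡sw  ← ∧-elim (s a == s u) labels
    = proj₂ valid a b ab∈H
        (trans (sameSupernode⇒sameCluster (==⇒≡ (s a) (s u) sa≡su))
               (trans cu≡cw (sym (sameSupernode⇒sameCluster (==⇒≡ (s b) (s w) sb≡sw)))))

  inSameClusterSN⇒sameCluster : ∀ {U W} → inSameClusterSN s c U W ≡ true →
                                ∀ {u w} → s u ≡ U → s w ≡ W → c u ≡ c w
  inSameClusterSN⇒sameCluster {U} {W} same {u} {w} su≡U sw≡W
    with u₀ , u₀-same    ← anyFin-∃ n _ same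
    with w₀ , u₀w₀-same  ← anyFin-∃ n _ u₀-same
    with su₀≡U , rest    ← ∧-elim (s u₀ == U) u₀w₀-same
    with sw₀≡W , cu₀≡cw₀ ← ∧-elim (s w₀ == W) rest
    = trans (sameSupernode⇒sameCluster (trans su≡U (sym (==⇒≡ (s u₀) U su₀≡U))))
            (trans (==⇒≡ (c u₀) (c w₀) cu₀≡cw₀)
                   (sameSupernode⇒sameCluster (trans (==⇒≡ (s w₀) W sw₀≡W) (sym sw≡W))))

  sameCluster separated : Fin n → Fin n → Bool
  sameCluster u w = c u == c w
  separated   u w = not (sameCluster u w)

  sameCluster-sym : Symmetricᵇ sameCluster
  sameCluster-sym u w = ==-sym (c u) (c w)

  separated-sym : Symmetricᵇ separated
  separated-sym u w = cong not (sameCluster-sym u w)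

  -- keyed by supernode label, matching the convention U < W of sumS
  missingInside : PairSet n → ℕ
  missingInside X = pairsBy (toℕ ∘ s) (missingOn E sameCluster X)

  missingAcross : PairSet n → ℕ
  missingAcross X = pairsBy toℕ (missingOn E separated X)

  CrossSubset : PairSet n → Set
  CrossSubset X = ∀ u w → s u ≢ s w → InPair X u w → InPair E u w

  Invariant : PairSet n → Set
  Invariant X = missingInside X ≤ missingAcross X × CrossSubset X

  sameCluster⇒E₂ : ∀ {u w} → c u ≡ c w → InPair E u w → InPair (E₂ s E H) u w
  sameCluster⇒E₂ {u} {w} cu≡cw uw∈E
    rewrite uw∈E | ¬-not {hostileSN s H (s u) (s w)} (λ h → hostile⇒separated h cu≡cw)
    = proj₂ (∧-elim (E u w ∨ E w u) uw∈E)

  crossE₁⇒E : ∀ u w → s u ≢ s w → E₁ s E u w ≡ true → InPair E u w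
  crossE₁⇒E u w su≢sw uw∈E₁ with ∨-elim (adj E u w) uw∈E₁
  ... | inj₁ uw∈E = uw∈E
  ... | inj₂ same = ⊥-elim (su≢sw (==⇒≡ (s u) (s w) (proj₁ (∧-elim (s u == s w) same))))

  E₂-crossSubset : CrossSubset (E₂ s E H)
  E₂-crossSubset u w su≢sw uw∈E₂
    with ∨-elim (E₂ s E H u w) (proj₁ (∧-elim (E₂ s E H u w ∨ E₂ s E H w u) uw∈E₂))
  ... | inj₁ uw = crossE₁⇒E u w su≢sw (proj₁ (∧-elim (E₁ s E u w) uw))
  ... | inj₂ wu =
    trans (adj-sym E u w) (crossE₁⇒E w u (su≢sw ∘ sym) (proj₁ (∧-elim (E₁ s E w u) wu)))

  invariant-E₂ : Invariant (E₂ s E H)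
  invariant-E₂ = ≤-trans (≤-trans (ΣΣ-mono n nothingMissing) (≤-reflexive (ΣΣ-zero n))) z≤n
               , E₂-crossSubset
    where
    nothingMissing : ∀ u w →
                     ind ((toℕ (s u) <ᵇ toℕ (s w)) ∧ missingOn E sameCluster (E₂ s E H) u w) ≤ 0
    nothingMissing u w = ind-mono λ h →
      let cu==cw , uw∈E∖E₂ = ∧-elim (sameCluster u w) (proj₂ (∧-elim (toℕ (s u) <ᵇ toℕ (s w)) h))
          uw∈E , uw∉E₂     = ∧-elim (adj E u w) uw∈E∖E₂
      in subst (λ x → not x ≡ true) (sameCluster⇒E₂ (==⇒≡ (c u) (c w) cu==cw) uw∈E) uw∉E₂

  invariant-step : ∀ {X Y} → Step s H X Y → Invariant X → Invariant Y
  invariant-step {X} (step u₁ u₂ u₃ u₃' s₁≢s₂ s₁≢s₃ s₂≢s₃ s₃≡s₃' hostile u₁u₃∈X u₂u₃'∈X)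
                 (inside≤across , X⊆E) =
    bound , λ u w su≢sw uw∈Y →
              X⊆E u w su≢sw (PairRemoved⇒⊆ removed₁ (PairRemoved⇒⊆ removed₂ uw∈Y))
    where
    X₁ : PairSet n
    X₁ = without X u₁ u₃
    removed₁ : PairRemoved X u₁ u₃ X₁
    removed₁ = without-removes X u₁ u₃
    removed₂ : PairRemoved X₁ u₂ u₃' (remove2 X u₁ u₃ u₂ u₃')
    removed₂ = remove2-removes X u₁ u₃ u₂ u₃'

    s₂≢s₃' : s u₂ ≢ s u₃'
    s₂≢s₃' s₂≡s₃' = s₂≢s₃ (trans s₂≡s₃' (sym s₃≡s₃'))
    u₁≢u₃ : u₁ ≢ u₃
    u₁≢u₃ = s₁≢s₃ ∘ cong s
    u₂≢u₃' : u₂ ≢ u₃'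
    u₂≢u₃' = s₂≢s₃' ∘ cong s

    u₂u₃'≢u₁u₃ : samePair u₂ u₃' u₁ u₃ ≡ false
    u₂u₃'≢u₁u₃ = ¬-not λ h → [ (λ (u₂≡u₁ , _) → s₁≢s₂ (sym (cong s u₂≡u₁)))
                              , (λ (u₂≡u₃ , _) → s₂≢s₃ (cong s u₂≡u₃)) ]′
                              (samePair⇒ u₂ u₃' u₁ u₃ h)
    u₂u₃'∈X₁ : InPair X₁ u₂ u₃'
    u₂u₃'∈X₁ rewrite adj-removed removed₁ u₂ u₃' | u₂u₃'∈X | u₂u₃'≢u₁u₃ = refl

    notBoth : sameCluster u₁ u₃ ≡ true → sameCluster u₂ u₃' ≡ true → ⊥
    notBoth c₁≡c₃ c₂≡c₃' = hostile⇒separated hostile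
      (trans (==⇒≡ (c u₁) (c u₃) c₁≡c₃)
             (trans (sameSupernode⇒sameCluster s₃≡s₃') (sym (==⇒≡ (c u₂) (c u₃') c₂≡c₃'))))

    bound : missingInside (remove2 X u₁ u₃ u₂ u₃') ≤ missingAcross (remove2 X u₁ u₃ u₂ u₃')
    bound = begin
      missingInside (remove2 X u₁ u₃ u₂ u₃')
        ≤⟨ missingOn-removal-≤ E (toℕ ∘ s) sameCluster sameCluster-sym removed₂ u₂≢u₃' ⟩
      missingInside X₁ + ind (sameCluster u₂ u₃')
        ≤⟨ +-monoˡ-≤ _ (missingOn-removal-≤ E (toℕ ∘ s) sameCluster sameCluster-sym
                                             removed₁ u₁≢u₃) ⟩
      missingInside X + ind (sameCluster u₁ u₃) + ind (sameCluster u₂ u₃')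
        ≤⟨ +-monoˡ-≤ _ (+-monoˡ-≤ _ inside≤across) ⟩
      missingAcross X + ind (sameCluster u₁ u₃) + ind (sameCluster u₂ u₃')
        ≡⟨ +-assoc (missingAcross X) _ _ ⟩
      missingAcross X + (ind (sameCluster u₁ u₃) + ind (sameCluster u₂ u₃'))
        ≤⟨ +-monoʳ-≤ (missingAcross X) (ind-not-pair _ _ notBoth) ⟩
      missingAcross X + (ind (separated u₁ u₃) + ind (separated u₂ u₃'))
        ≡⟨ +-assoc (missingAcross X) _ _ ⟨
      missingAcross X + ind (separated u₁ u₃) + ind (separated u₂ u₃')
        ≤⟨ +-monoˡ-≤ _ (missingOn-removal-≥ E toℕ separated separated-sym removed₁
                          (u₁≢u₃ ∘ toℕ-injective) u₁u₃∈X (X⊆E u₁ u₃ s₁≢s₃ u₁u₃∈X)) ⟩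
      missingAcross X₁ + ind (separated u₂ u₃')
        ≤⟨ missingOn-removal-≥ E toℕ separated separated-sym removed₂
             (u₂≢u₃' ∘ toℕ-injective) u₂u₃'∈X₁ (X⊆E u₂ u₃' s₂≢s₃' u₂u₃'∈X) ⟩
      missingAcross (remove2 X u₁ u₃ u₂ u₃')
        ∎
      where open ≤-Reasoning

  invariant-star : ∀ {X Y} → Star (Step s H) X Y → Invariant X → Invariant Y
  invariant-star = fold (λ X Y → Invariant X → Invariant Y)
                        (λ step rest → rest ∘ invariant-step step) id

  sumS-≤-missingInside : ∀ X → CrossSubset X → sumS s c E X ≤ missingInside X
  sumS-≤-missingInside X X⊆E = begin
    sumS s c E X
      ≤⟨ ΣΣ-mono n crossDiff-≤ ⟩
    ΣΣ n (λ U W → ΣΣ n (λ u w → ind ((U == s u) ∧ ((W == s w) ∧ G u w))))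
      ≡⟨ ΣΣ-comm n _ ⟩
    ΣΣ n (λ u w → ΣΣ n (λ U W → ind ((U == s u) ∧ ((W == s w) ∧ G u w))))
      ≡⟨ ΣΣ-cong n (λ u w → ΣΣ-δ n (s u) (s w) (λ _ _ → G u w)) ⟩
    missingInside X
      ∎
    where
    open ≤-Reasoning
    G : Fin n → Fin n → Bool
    G u w = (toℕ (s u) <ᵇ toℕ (s w)) ∧ missingOn E sameCluster X u w

    inCross : ∀ {U W} → (toℕ U <ᵇ toℕ W) ≡ true → inSameClusterSN s c U W ≡ true → ∀ u w →
              ((s u == U) ∧ (s w == W) ∧ (adj E u w xor adj X u w)) ≡ true →
              ((U == s u) ∧ ((W == s w) ∧ G u w)) ≡ true
    inCross {U} {W} U<W same u w h
      with su==U , rest   ← ∧-elim (s u == U) h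
      with sw==W , differ ← ∧-elim (s w == W) rest
      with refl ← ==⇒≡ (s u) U su==U
      with refl ← ==⇒≡ (s w) W sw==W
      = ∧-intro (≡⇒== {a = s u} refl) (∧-intro (≡⇒== {a = s w} refl) (∧-intro U<W (∧-intro
          (≡⇒== (inSameClusterSN⇒sameCluster same refl refl))
          (xor-⊆ (adj E u w) (adj X u w) (X⊆E u w (<⇒≢ (<ᵇ⇒<′ _ _ U<W) ∘ cong toℕ)) differ))))

    crossDiff-≤ : ∀ U W →
                  (if (toℕ U <ᵇ toℕ W) ∧ inSameClusterSN s c U W then crossDiff s E X U W else 0)
                  ≤ ΣΣ n (λ u w → ind ((U == s u) ∧ ((W == s w) ∧ G u w)))
    crossDiff-≤ U W with toℕ U <ᵇ toℕ W in U<W | inSameClusterSN s c U W in same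
    ... | true  | true  = ΣΣ-mono n (λ u w → ind-mono (inCross U<W same u w))
    ... | true  | false = z≤n
    ... | false | _     = z≤n

  missingAcross-≤-cost : ∀ X → missingAcross X ≤ cost E c
  missingAcross-≤-cost X = ΣΣ-mono n λ u w → ind-mono λ h →
    let u<w , rest          = ∧-elim (toℕ u <ᵇ toℕ w) h
        split , uw∈E∖X      = ∧-elim (separated u w) rest
    in ∧-intro u<w (error u w (not-injective {y = false} split) (proj₁ (∧-elim (adj E u w) uw∈E∖X)))
    where
    error : ∀ u w → sameCluster u w ≡ false → InPair E u w →
            (adj E u w xor adj (clusterEdges c) u w) ≡ true
    error u w split uw∈E rewrite uw∈E | split | ==-sym (c w) (c u) | split = refl

lemma11 : ∀ {n} (E F H : PairSet n) (s : Fin n → Fin n) →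
          IsSupernodeLabelling F s →
          (c : Clustering n) → OptimalValid E F H c →
          (E₃ : PairSet n) → IsE₃ s E H E₃ →
          sumS s c E E₃ ≤ cost E c
lemma11 E F H s supernodes c (valid , _) E₃ (steps , _) = begin
  sumS s c E E₃     ≤⟨ sumS-≤-missingInside E₃ (proj₂ invariant-E₃) ⟩
  missingInside E₃  ≤⟨ proj₁ invariant-E₃ ⟩
  missingAcross E₃  ≤⟨ missingAcross-≤-cost E₃ ⟩
  cost E c          ∎
  where
  open ≤-Reasoning
  open ValidClustering E F H s supernodes c valid
  invariant-E₃ : Invariant E₃
  invariant-E₃ = invariant-star steps invariant-E₂
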